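{- Let $\mathcal{P}$ be a poset on $[n]$ and let $I,J\in\mathcal{I}(\mathcal{P})$. The following are equivalent: (i) $\mathrm{supp}(u)\cap(J^c)_M=\emptyset$ for every $u\in S_I$; (ii) $M(I)\cap(J^c)_M=\emptyset$; (iii) $I\cap(J^c)_M=\emptyset$; (iv) $I_M\cap J^c=\emptyset$.
   Context: Poset conventions: - $\mathcal{P}$ is a partial order on $[n]$, $\mathcal{I}(\mathcal{P})$ is its set of order ideals, and $\mathcal{P}^*$ is the dual poset (reversed order). - For $I\in\mathcal{I}(\mathcal{P})$, $M(I)$ is the set of maximal elements of $I$ in $\mathcal{P}$ and $I_M=I\setminus M(I)$. - $J^c=[n]\setminus J$ is an order ideal of $\mathcal{P}^*$. $M(J^c)$ is its set of maximal elements with respect to $\mathcal{P}^*$, and $(J^c)_M=J^c\setminus M(J^c)$. Spheres: $S_I=\{v\in\mathbb{F}_q^n:\langle\mathrm{supp}(v)\rangle_{\mathcal{P}}=I\}$, where $\mathrm{supp}(v)=\{i:v_i\neq0\}$ and $\langle X\rangle_{\mathcal{P}}$ is the smallest order ideal of $\mathcal{P}$ containing $X$. -}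

module Defs where

open import Level using (0ℓ)
open import Data.Nat using (ℕ)
open import Data.Fin using (Fin)
open import Data.Fin.Subset using (Subset; _∈_; _∉_)
open import Data.Product using (_×_; ∃)
open import Data.Empty using (⊥)
open import Relation.Nullary using (¬_)
open import Relation.Unary using (Pred)
open import Relation.Binary using (Rel)
open import Relation.Binary.PropositionalEquality using (_≡_)
open import Function using (flip)
open import Algebra.Bundles using (CommutativeRing)

record FiniteField : Set₁ where
  field
    commRing : CommutativeRing 0ℓ 0ℓ
  open CommutativeRing commRing public
  field
    0≉1      : ¬ (0# ≈ 1#)
    inverse  : ∀ x → ¬ (x ≈ 0#) → ∃ λ y → (x * y) ≈ 1#
    size     : ℕ
    enum     : Fin size → Carrier
    enum-surj : ∀ x → ∃ λ i → enum i ≈ x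

module _ {n : ℕ} (_≼_ : Rel (Fin n) 0ℓ) where

  IsIdeal : Subset n → Set
  IsIdeal I = ∀ {x y} → y ≼ x → x ∈ I → y ∈ I

  Maximal : Pred (Fin n) 0ℓ → Pred (Fin n) 0ℓ
  Maximal A i = A i × (∀ {j} → A j → i ≼ j → j ≡ i)

  -- A_M = A \ M(A)
  NonMaximal : Pred (Fin n) 0ℓ → Pred (Fin n) 0ℓ
  NonMaximal A i = A i × ¬ Maximal A i

  IsGeneratedIdeal : Pred (Fin n) 0ℓ → Subset n → Set
  IsGeneratedIdeal X I =
    IsIdeal I × (∀ i → X i → i ∈ I) ×
    (∀ K → IsIdeal K → (∀ i → X i → i ∈ K) → ∀ i → i ∈ I → i ∈ K)

set : {n : ℕ} → Subset n → Pred (Fin n) 0ℓ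
set I i = i ∈ I

compl : {n : ℕ} → Subset n → Pred (Fin n) 0ℓ
compl J i = i ∉ J

Disjoint : {n : ℕ} → Pred (Fin n) 0ℓ → Pred (Fin n) 0ℓ → Set
Disjoint A B = ∀ i → A i → B i → ⊥

module _ (F : FiniteField) where
  open FiniteField F

  supp : {n : ℕ} → (Fin n → Carrier) → Pred (Fin n) 0ℓ
  supp v i = ¬ (v i ≈ 0#)

  -- v ∈ S_I  iff  ⟨supp v⟩_P = I
  InSphere : {n : ℕ} → Rel (Fin n) 0ℓ → Subset n → (Fin n → Carrier) → Set
  InSphere _≼_ I v = IsGeneratedIdeal _≼_ (supp v) I

-- (J^c)_M : J^c minus its maximal elements w.r.t. the dual order P*
dualNonMax : {n : ℕ} → Rel (Fin n) 0ℓ → Subset n → Pred (Fin n) 0ℓ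
dualNonMax _≼_ J = NonMaximal (flip _≼_) (compl J)

module Submission where

-- Everything is routed through (iii).
--  * (i) ⇔ (iii): every u ∈ S_I has supp(u) ⊆ I, and the indicator vector
--    of I lies in S_I with support exactly I.
--  * (ii) ⇔ (iii): D is upward closed relative to J^c (if t ∉ J and t ≺ j
--    then j ∉ J and t witnesses that j is not P*-maximal in J^c).  A general
--    finiteness lemma then says: a set B that is upward closed inside A and
--    meets A already contains a maximal element of A.
--  * (iii) ⇔ (iv): both directions only use that an element lying strictly
--    below another element of a set is not maximal in that set, applied once
--    to P (for I) and once to P* (for J^c).

open import Defs
open import Level using (0ℓ)
open import Data.Nat using (ℕ; zero; suc; _≤_; _<_; s≤s)
open import Data.Nat.Properties using (≤-reflexive; <-≤-trans)
open import Data.Fin using (Fin; _≟_)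
open import Data.Fin.Subset using (Subset; _∈_; _∉_)
open import Data.Fin.Subset.Properties using (_∈?_)
open import Data.Product using (_×_; _,_; proj₁)
open import Data.Empty using (⊥; ⊥-elim)
open import Data.List using (List; []; _∷_; length; filter; allFin)
open import Data.List.Properties using (filter-notAll; length-tabulate)
open import Data.List.Membership.Propositional using () renaming (_∈_ to _∈L_)
open import Data.List.Membership.Propositional.Properties using (∈-filter⁺; ∈-allFin)
import Data.List.Relation.Unary.Any as Any
open import Relation.Nullary using (¬_; yes; no; ¬?)
open import Relation.Unary using (Pred)
open import Relation.Binary using (Rel; IsPartialOrder)
open import Relation.Binary.PropositionalEquality using (_≡_; refl; sym; subst)
open import Function using (flip)
open import Function.Bundles using (_⇔_; mk⇔)

module _ {n : ℕ} (R : Rel (Fin n) 0ℓ) {A : Pred (Fin n) 0ℓ} where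

  maximal-unless : ∀ {i} → A i → (∀ {k} → A k → R i k → ¬ k ≡ i → ⊥) → Maximal R A i
  maximal-unless {i} i∈A no-above = i∈A , above
    where
    above : ∀ {k} → A k → R i k → k ≡ i
    above {k} k∈A iRk with k ≟ i
    ... | yes k≡i = k≡i
    ... | no  k≢i = ⊥-elim (no-above k∈A iRk k≢i)

  below-nonMaximal : ∀ {j i} → A j → A i → R j i → ¬ i ≡ j → NonMaximal R A j
  below-nonMaximal j∈A i∈A jRi i≢j = j∈A , λ (_ , above) → i≢j (above i∈A jRi)

-- X without t keeps the entries of X different from t; it is strictly
-- shorter than X when t occurs in X (this is the termination measure below).
without : {n : ℕ} → Fin n → List (Fin n) → List (Fin n)
without t = filter (λ x → ¬? (x ≟ t))

without-shorter : {n : ℕ} {t : Fin n} (X : List (Fin n)) → t ∈L X → length (without t X) < length X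
without-shorter X t∈X = filter-notAll _ X (Any.map (λ t≡x x≢t → x≢t (sym t≡x)) t∈X)

module _ {n : ℕ} {_≼_ : Rel (Fin n) 0ℓ} (po : IsPartialOrder _≡_ _≼_)
         {A B : Pred (Fin n) 0ℓ} (B-upward : ∀ {t j} → A t → B t → A j → t ≼ j → B j)
         (noMaxInB : Disjoint (Maximal _≼_ A) B) where
  open IsPartialOrder po using (antisym; trans; reflexive)

  -- Climbing inside A along B: starting from t ∈ A ∩ B whose up-set in A is
  -- covered by a list X of length ≤ N, either t is maximal in A (contradicting
  -- noMaxInB) or some j ∈ A strictly above t is in B, and the up-set of j is
  -- covered by X without t, a strictly shorter list.
  climb : ∀ N (X : List (Fin n)) → length X ≤ N → ∀ {t} → A t → B t →
          (∀ {j} → A j → t ≼ j → j ∈L X) → ⊥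
  climb zero [] _ t∈A _ covers with covers t∈A (reflexive refl)
  ... | ()
  climb (suc N) X len {t} t∈A t∈B covers =
    noMaxInB t (maximal-unless _≼_ t∈A climb-above) t∈B
    where
    shorter : length (without t X) ≤ N
    shorter with s≤s r ← <-≤-trans (without-shorter X (covers t∈A (reflexive refl))) len = r
    climb-above : ∀ {j} → A j → t ≼ j → ¬ j ≡ t → ⊥
    climb-above {j} j∈A t≼j j≢t = climb N (without t X) shorter j∈A (B-upward t∈A t∈B j∈A t≼j) covers′
      where
      covers′ : ∀ {k} → A k → j ≼ k → k ∈L without t X
      covers′ k∈A j≼k = ∈-filter⁺ _ (covers k∈A (trans t≼j j≼k))
        λ k≡t → j≢t (antisym (subst (j ≼_) k≡t j≼k) t≼j)

  meets-maximal : Disjoint A B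
  meets-maximal t t∈A t∈B =
    climb n (allFin n) (≤-reflexive (length-tabulate _)) t∈A t∈B (λ {j} _ _ → ∈-allFin j)

module _ {n : ℕ} {_≼_ : Rel (Fin n) 0ℓ} {J : Subset n} (idJ : IsIdeal _≼_ J) where

  dualNonMax-above : ∀ {t j} → t ∉ J → t ≼ j → ¬ j ≡ t → dualNonMax _≼_ J j
  dualNonMax-above t∉J t≼j j≢t =
    below-nonMaximal (flip _≼_) (λ j∈J → t∉J (idJ t≼j j∈J)) t∉J t≼j (λ t≡j → j≢t (sym t≡j))

module _ (F : FiniteField) {n : ℕ} (_≼_ : Rel (Fin n) 0ℓ) where
  open FiniteField F using (Carrier; 0#; 1#; 0≉1) renaming (sym to ≈-sym; refl to ≈-refl)

  indicator : Subset n → Fin n → Carrier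
  indicator I i with i ∈? I
  ... | yes _ = 1#
  ... | no  _ = 0#

  supp-indicator⁺ : ∀ {I i} → i ∈ I → supp F (indicator I) i
  supp-indicator⁺ {I} {i} i∈I with i ∈? I
  ... | yes _   = λ 1≈0 → 0≉1 (≈-sym 1≈0)
  ... | no  i∉I = ⊥-elim (i∉I i∈I)

  supp-indicator⁻ : ∀ {I i} → supp F (indicator I) i → i ∈ I
  supp-indicator⁻ {I} {i} i∈supp with i ∈? I
  ... | yes i∈I = i∈I
  ... | no  _   = ⊥-elim (i∈supp ≈-refl)

  -- Since supp(1_I) = I, the indicator of an order ideal I lies in S_I.
  indicator-inSphere : ∀ {I} → IsIdeal _≼_ I → InSphere F _≼_ I (indicator I)
  indicator-inSphere idI =
    idI , (λ _ → supp-indicator⁻) , λ _ _ supp⊆K _ i∈I → supp⊆K _ (supp-indicator⁺ i∈I)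

module Implications (F : FiniteField) {n : ℕ} {_≼_ : Rel (Fin n) 0ℓ} (po : IsPartialOrder _≡_ _≼_)
         {I J : Subset n} (idI : IsIdeal _≼_ I) (idJ : IsIdeal _≼_ J) where

  private
    D : Pred (Fin n) 0ℓ
    D = dualNonMax _≼_ J

  i⇒iii : (∀ u → InSphere F _≼_ I u → Disjoint (supp F u) D) → Disjoint (set I) D
  i⇒iii all-u i i∈I = all-u _ (indicator-inSphere F _≼_ idI) i (supp-indicator⁺ F _≼_ i∈I)

  iii⇒i : Disjoint (set I) D → ∀ u → InSphere F _≼_ I u → Disjoint (supp F u) D
  iii⇒i I∩D=∅ u (_ , supp⊆I , _) i i∈supp = I∩D=∅ i (supp⊆I i i∈supp)

  iii⇒ii : Disjoint (set I) D → Disjoint (Maximal _≼_ (set I)) D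
  iii⇒ii I∩D=∅ i (i∈I , _) = I∩D=∅ i i∈I

  ii⇒iii : Disjoint (Maximal _≼_ (set I)) D → Disjoint (set I) D
  ii⇒iii = meets-maximal po D-upward
    where
    D-upward : ∀ {t j} → t ∈ I → D t → j ∈ I → t ≼ j → D j
    D-upward {t} {j} _ t∈D _ t≼j with j ≟ t
    ... | yes refl = t∈D
    ... | no  j≢t  = dualNonMax-above idJ (proj₁ t∈D) t≼j j≢t

  iii⇒iv : Disjoint (set I) D → Disjoint (NonMaximal _≼_ (set I)) (compl J)
  iii⇒iv I∩D=∅ i (i∈I , nonMax) i∉J = nonMax (maximal-unless _≼_ i∈I
    λ {k} k∈I i≼k k≢i → I∩D=∅ k k∈I (dualNonMax-above idJ i∉J i≼k k≢i))

  iv⇒iii : Disjoint (NonMaximal _≼_ (set I)) (compl J) → Disjoint (set I) D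
  iv⇒iii IM∩Jᶜ=∅ i i∈I (i∉J , nonMin) = nonMin (maximal-unless (flip _≼_) i∉J
    λ {j} j∉J j≼i j≢i → IM∩Jᶜ=∅ j (below-nonMaximal _≼_ (idI j≼i i∈I) i∈I j≼i (λ i≡j → j≢i (sym i≡j))) j∉J)

lemma3p6 : (F : FiniteField) (n : ℕ) (_≼_ : Rel (Fin n) 0ℓ) → IsPartialOrder _≡_ _≼_ →
    (I J : Subset n) → IsIdeal _≼_ I → IsIdeal _≼_ J →
    ((∀ u → InSphere F _≼_ I u → Disjoint (supp F u) (dualNonMax _≼_ J))
      ⇔ Disjoint (Maximal _≼_ (set I)) (dualNonMax _≼_ J))
    × (Disjoint (Maximal _≼_ (set I)) (dualNonMax _≼_ J)
      ⇔ Disjoint (set I) (dualNonMax _≼_ J))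
    × (Disjoint (set I) (dualNonMax _≼_ J)
      ⇔ Disjoint (NonMaximal _≼_ (set I)) (compl J))
lemma3p6 F n _≼_ po I J idI idJ =
  mk⇔ (λ i → iii⇒ii (i⇒iii i)) (λ ii → iii⇒i (ii⇒iii ii)) ,
  mk⇔ ii⇒iii iii⇒ii ,
  mk⇔ iii⇒iv iv⇒iii
  where open Implications F po idI idJ
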